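{- Let $n\ge 4$ be even. If a vertex $s\in V_n$ of the Goldbach factorization graph $F_n$ has a loop $(s,s)\in A_n$, then there is no arc $(s,t)\in A_n$ with $t\neq s$.
   Context: For an even integer $n\ge 4$, the Goldbach factorization graph is the directed weighted graph $F_n=(V_n,A_n,w_n)$ with vertex set $V_n=[2,n-2]\cap\mathbb{P}$ ($\mathbb{P}$ the set of primes), arc set $A_n=\{(s,t)\in V_n^2 : s \mid (n-t)\}$ (loops allowed), and weights $w_n((s,t))=\max\{e\ge 1: s^e\mid (n-t)\}$. -}

module Defs where

open import Data.Nat using (ℕ; _≤_; _∸_)
open import Data.Nat.Divisibility using (_∣_)
open import Data.Nat.Primality using (Prime)
open import Data.Product using (_×_)

IsVertex : ℕ → ℕ → Set
IsVertex n p = Prime p × 2 ≤ p × p ≤ n ∸ 2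

-- Arc set A_n: (s,t) ∈ V_n² with s ∣ (n - t)   (t ≤ n - 2, so truncated ∸ is exact)
IsArc : ℕ → ℕ → ℕ → Set
IsArc n s t = IsVertex n s × IsVertex n t × s ∣ (n ∸ t)

Even : ℕ → Set
Even n = 2 ∣ n

{-# OPTIONS --safe #-}
-- A loop at s means s ∣ n − s, hence s ∣ n. Then any arc (s , t) gives
-- s ∣ n − t and so s ∣ t; as t is prime and s ≠ 1, this forces t = s.
module Submission where

open import Defs
open import Data.Nat using (ℕ; _≤_; _∸_; s≤s)
open import Data.Nat.Properties using (≤-trans; m∸n≤m; m∸n+n≡m)
open import Data.Nat.Divisibility using (_∣_; ∣-refl; ∣m+n∣m⇒∣n; ∣m∸n∣n⇒∣m)
open import Data.Nat.Primality using (Prime; prime⇒irreducible)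
open import Data.Product using (Σ; _×_; _,_)
open import Data.Sum using (inj₁; inj₂)
open import Relation.Binary.PropositionalEquality using (_≡_; refl; sym; subst)
open import Relation.Nullary using (¬_)

∣m∸d⇒∣m : ∀ {d m} → d ≤ m → d ∣ m ∸ d → d ∣ m
∣m∸d⇒∣m {d} d≤m d∣m∸d = ∣m∸n∣n⇒∣m d d≤m d∣m∸d ∣-refl

∣m∣m∸n⇒∣n : ∀ {d m n} → n ≤ m → d ∣ m → d ∣ m ∸ n → d ∣ n
∣m∣m∸n⇒∣n {d} n≤m d∣m d∣m∸n =
  ∣m+n∣m⇒∣n (subst (d ∣_) (sym (m∸n+n≡m n≤m)) d∣m) d∣m∸n

vertex⇒≤ : ∀ {p n} → IsVertex n p → p ≤ n
vertex⇒≤ {n = n} (_ , _ , p≤n∸2) = ≤-trans p≤n∸2 (m∸n≤m n 2)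

≥2∣prime⇒≡ : ∀ {s t} → 2 ≤ s → Prime t → s ∣ t → s ≡ t
≥2∣prime⇒≡ 2≤s pt s∣t with prime⇒irreducible pt s∣t
... | inj₁ refl with s≤s () ← 2≤s
... | inj₂ s≡t = s≡t

loop⇒∣n : ∀ {n s} → IsArc n s s → s ∣ n
loop⇒∣n (vs , _ , s∣n∸s) = ∣m∸d⇒∣m (vertex⇒≤ vs) s∣n∸s

mainTheorem12 : (n : ℕ) → 4 ≤ n → Even n → (s : ℕ) → IsArc n s s →
    ¬ (Σ ℕ λ t → IsArc n s t × ¬ (t ≡ s))
mainTheorem12 n _ _ s loop (t , ((_ , 2≤s , _) , vt@(pt , _) , s∣n∸t) , t≢s) =
  t≢s (sym (≥2∣prime⇒≡ 2≤s pt s∣t))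
  where
  s∣t : s ∣ t
  s∣t = ∣m∣m∸n⇒∣n (vertex⇒≤ vt) (loop⇒∣n loop) s∣n∸t
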